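{- Let $G$ be a finite abelian group and let $A_1,\dots,A_m$ be a bimodal collection of pairwise disjoint nonempty subsets of $G$ that partition $G$, with sizes $k_1,\dots,k_m$. If $m>1$ and $k_i>1$ for some $1\le i\le m$, then $\{A_1,\dots,A_m\}$ is not an RWEDF.
   Context: $G$ is written additively, $G^*=G\setminus\{0\}$. For $\delta\in G^*$, $N_j(\delta)=|\{(a,b): a\in A_j,\ b\in A_i \text{ for some } i\neq j,\ a-b=\delta\}|$. The collection is bimodal if $N_j(\delta)\in\{0,k_j\}$ for all $\delta\in G^*$ and all $j$. It is an RWEDF if there is a rational $\ell$ with $\sum_i \frac{1}{k_i}N_i(\delta)=\ell$ for all $\delta\in G^*$. -}

module Defs where

open import Level using (0ℓ)
open import Algebra.Bundles using (AbelianGroup)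
open import Data.Bool using (Bool; true; false; _∧_; not; T)
open import Data.Nat as ℕ using (ℕ; zero; suc; NonZero)
open import Data.Nat.Properties using (m≤n⇒m≤1+n)
open import Data.Fin using (Fin)
open import Data.Fin.Properties using (_≟_)
open import Data.List using (List; []; _∷_; length; filterᵇ; cartesianProduct; foldr; map; allFin)
open import Data.Bool.ListAction using (any)
open import Data.List.Relation.Unary.Any using (Any; here; there)
open import Data.Product using (_×_; _,_; ∃; Σ)
open import Data.Integer using (+_)
open import Data.Rational as ℚ using (ℚ)
open import Relation.Nullary using (¬_; Dec; yes; no)
open import Relation.Nullary.Decidable using (⌊_⌋)
open import Relation.Binary.PropositionalEquality as P using (_≡_; refl)
open import Relation.Binary.Definitions using (Decidable)
open import Data.List.Relation.Unary.AllPairs using (AllPairs)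

record FiniteAbelianGroup : Set₁ where
  field
    abGroup  : AbelianGroup 0ℓ 0ℓ
  open AbelianGroup abGroup public
  field
    _≈?_     : Decidable _≈_
    elems    : List Carrier
    complete : ∀ x → Any (x ≈_) elems
    distinct : AllPairs (λ x y → ¬ (x ≈ y)) elems

module _ (G : FiniteAbelianGroup) where
  open FiniteAbelianGroup G

  _-G_ : Carrier → Carrier → Carrier
  a -G b = a ∙ (b ⁻¹)

  -- A family A_1..A_m of subsets of G, each given by a (≈-respecting)
  -- Boolean membership predicate.
  Family : ℕ → Set
  Family m = Fin m → Carrier → Bool

  record IsPartition {m : ℕ} (A : Family m) : Set where
    field
      respects : ∀ i {x y} → x ≈ y → A i x ≡ A i y
      nonempty : ∀ i → ∃ λ g → A i g ≡ true
      disjoint : ∀ i j g → ¬ (i ≡ j) → A i g ≡ true → A j g ≡ true → false ≡ true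
      covers   : ∀ g → ∃ λ i → A i g ≡ true

  size : {m : ℕ} → Family m → Fin m → ℕ
  size A j = length (filterᵇ (A j) elems)

  inOther : {m : ℕ} → Family m → Fin m → Carrier → Bool
  inOther {m} A j b = any (λ i → not ⌊ i ≟ j ⌋ ∧ A i b) (allFin m)

  N : {m : ℕ} → Family m → Fin m → Carrier → ℕ
  N A j δ = length (filterᵇ (λ p → cond p) (cartesianProduct elems elems))
    where
      cond : Carrier × Carrier → Bool
      cond (a , b) = A j a ∧ inOther A j b ∧ ⌊ (a -G b) ≈? δ ⌋

  Bimodal : {m : ℕ} → Family m → Set
  Bimodal A = ∀ δ → ¬ (δ ≈ ε) → ∀ j → (N A j δ ≡ 0) Data.Sum.⊎ (N A j δ ≡ size A j)
    where import Data.Sum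

  private
    filter-pos : (p : Carrier → Bool) (xs : List Carrier) (g : Carrier) →
                 (∀ {x y} → x ≈ y → p x ≡ p y) → p g ≡ true → Any (g ≈_) xs →
                 NonZero (length (filterᵇ p xs))
    filter-pos p (x ∷ xs) g resp pg (here g≈x) with p x | P.trans (P.sym pg) (resp g≈x)
    ... | true | _ = _
    filter-pos p (x ∷ xs) g resp pg (there a) with p x
    ... | true  = _
    ... | false = filter-pos p xs g resp pg a

  size-nonzero : {m : ℕ} (A : Family m) → IsPartition A → ∀ i → NonZero (size A i)
  size-nonzero A P i with IsPartition.nonempty P i
  ... | g , Ag = filter-pos (A i) elems g (IsPartition.respects P i) Ag (complete g)

  sumℚ : {m : ℕ} → (Fin m → ℚ) → ℚ
  sumℚ {m} f = foldr ℚ._+_ ℚ.0ℚ (map f (allFin m))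

  -- RWEDF: there is a rational ℓ with Σ_i N_i(δ)/k_i = ℓ for all δ ∈ G*
  -- (k_i ≠ 0 is guaranteed by the partition hypothesis, i.e. nonemptiness).
  RWEDF : {m : ℕ} (A : Family m) → IsPartition A → Set
  RWEDF A P = ∃ λ (ℓ : ℚ) → ∀ δ → ¬ (δ ≈ ε) →
    sumℚ (λ i → ((+ N A i δ) ℚ./ size A i) {{size-nonzero A P i}}) ≡ ℓ

module Submission where

-- Call Aⱼ δ-invariant when Aⱼ − δ ⊆ Aⱼ. Three facts drive the proof.
--  (1) If Nⱼ(δ) = 0 then Aⱼ is δ-invariant: otherwise some a ∈ Aⱼ has
--      a − δ in another part, and (a, a − δ) is counted by Nⱼ(δ).
--  (2) If some a ∈ Aⱼ has a − δ ∈ Aⱼ then Nⱼ(δ) < kⱼ: every a ∈ Aⱼ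
--      contributes at most one pair to Nⱼ(δ), and this a contributes none.
--  (3) With at least two parts, it is impossible that every δ has a
--      δ-invariant part: choosing such a part j(δ) and a representative
--      r(j) of each part, δ ↦ r(j(δ)) − δ is an injection G → G missing
--      a representative, contradicting finiteness (pigeonhole).
-- For the theorem take a ≠ a' in Aᵢ and δ₀ = a' − a. By (2) and
-- bimodality Nᵢ(δ₀) = 0, so Σⱼ Nⱼ(δ₀)/kⱼ < m. A nonzero δ without a
-- vanishing Nⱼ(δ) has Nⱼ(δ) = kⱼ for all j by bimodality, so its weighted
-- sum is m ≠ that of δ₀. Hence an RWEDF would give every nonzero δ a
-- vanishing Nⱼ(δ), i.e. by (1) a δ-invariant part, contradicting (3).

open import Defs
open import Data.Nat using (ℕ; _<_)
open import Data.Fin using (Fin)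
open import Data.Product using (∃)
open import Relation.Nullary using (¬_)

import Algebra.Properties.AbelianGroup as AbelianGroupProperties
open import Data.Bool using (Bool; true; false; _∧_; not)
open import Data.Bool.ListAction using (any)
open import Data.Bool.Properties using (∨-zeroʳ; ¬-not)
open import Data.Empty using (⊥-elim)
open import Data.Fin using (zero; suc)
import Data.Fin.Properties as Fin
import Data.Integer as ℤ
open import Data.List using (List; []; _∷_; _++_; map; length; lookup; filterᵇ; cartesianProduct; foldr; allFin)
open import Data.List.Membership.Propositional using (_∈_)
open import Data.List.Membership.Propositional.Properties using (∈-allFin; ∈-lookup)
open import Data.List.Relation.Unary.All as All using (All; []; _∷_)
open import Data.List.Relation.Unary.AllPairs using (AllPairs; []; _∷_)
open import Data.List.Relation.Unary.Any as Any using (Any; here; there)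
open import Data.List.Relation.Unary.Any.Properties using (lookup-index)
import Data.Nat as ℕ
open import Data.Nat using (zero; suc; _+_; _≤_; z≤n; s≤s; NonZero)
import Data.Nat.Properties as ℕ
open import Data.Product using (_×_; _,_; proj₁; proj₂; ∃₂; map₂)
open import Data.Rational as ℚ using (ℚ)
import Data.Rational.Properties as ℚ
open import Data.Sum using (_⊎_; inj₁; inj₂)
open import Relation.Nullary using (Dec; yes; no)
open import Relation.Nullary.Decidable using (⌊_⌋; decidable-stable)
open import Relation.Binary.PropositionalEquality using (_≡_; _≢_; refl; sym; trans; cong; subst)

-- Boolean counting over lists

bit : Bool → ℕ
bit true  = 1
bit false = 0

count : {X : Set} → (X → Bool) → List X → ℕ
count p []       = 0
count p (x ∷ xs) = bit (p x) + count p xs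

length-filterᵇ : {X : Set} (p : X → Bool) (xs : List X) → length (filterᵇ p xs) ≡ count p xs
length-filterᵇ p []       = refl
length-filterᵇ p (x ∷ xs) with p x
... | true  = cong suc (length-filterᵇ p xs)
... | false = length-filterᵇ p xs

count-++ : {X : Set} (p : X → Bool) (xs ys : List X) → count p (xs ++ ys) ≡ count p xs + count p ys
count-++ p []       ys = refl
count-++ p (x ∷ xs) ys = trans (cong (bit (p x) +_) (count-++ p xs ys)) (sym (ℕ.+-assoc (bit (p x)) _ _))

count-map : {X Y : Set} (p : Y → Bool) (f : X → Y) (xs : List X) → count p (map f xs) ≡ count (λ x → p (f x)) xs
count-map p f []       = refl
count-map p f (x ∷ xs) = cong (bit (p (f x)) +_) (count-map p f xs)

count-cartesian : {X Y : Set} (c : X × Y → Bool) (x : X) (xs : List X) (ys : List Y) →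
  count c (cartesianProduct (x ∷ xs) ys) ≡ count (λ y → c (x , y)) ys + count c (cartesianProduct xs ys)
count-cartesian c x xs ys = trans (count-++ c (map (x ,_) ys) (cartesianProduct xs ys))
  (cong (_+ count c (cartesianProduct xs ys)) (count-map c (x ,_) ys))

count-pos : {X : Set} (p : X → Bool) (xs : List X) → Any (λ x → p x ≡ true) xs → 0 < count p xs
count-pos p (x ∷ xs) (here px) rewrite px = s≤s z≤n
count-pos p (x ∷ xs) (there w) = ℕ.<-≤-trans (count-pos p xs w) (ℕ.m≤n+m _ (bit (p x)))

count-pos⁻¹ : {X : Set} (p : X → Bool) (xs : List X) → 0 < count p xs → Any (λ x → p x ≡ true) xs
count-pos⁻¹ p (x ∷ xs) pos with p x in px
... | true  = here px
... | false = there (count-pos⁻¹ p xs pos)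

count-none : {X : Set} (p : X → Bool) (xs : List X) → (∀ x → p x ≡ false) → count p xs ≡ 0
count-none p []       none = refl
count-none p (x ∷ xs) none rewrite none x = count-none p xs none

count-atMostOne : {X : Set} (R : X → X → Set) (p : X → Bool) (xs : List X) → AllPairs R xs →
  (∀ {y z} → p y ≡ true → p z ≡ true → ¬ R y z) → count p xs ≤ 1
count-atMostOne R p []       []             clash = z≤n
count-atMostOne R p (x ∷ xs) (Rx ∷ Rxs) clash with p x in px
... | true  = ℕ.≤-reflexive (cong suc (restEmpty xs Rx))
  where
  restEmpty : ∀ ys → All (R x) ys → count p ys ≡ 0
  restEmpty []       []         = refl
  restEmpty (y ∷ ys) (Rxy ∷ Rxys) with p y in py
  ... | true  = ⊥-elim (clash px py Rxy)
  ... | false = restEmpty ys Rxys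
... | false = count-atMostOne R p xs Rxs clash

twoWitnesses : {X : Set} (R : X → X → Set) (p : X → Bool) (xs : List X) → AllPairs R xs →
  1 < count p xs → ∃₂ λ y z → p y ≡ true × p z ≡ true × R y z
twoWitnesses R p (x ∷ xs) (Rx ∷ Rxs) many with p x in px
... | false = twoWitnesses R p xs Rxs many
... | true with many
...   | s≤s pos = partner xs Rx (count-pos⁻¹ p xs pos)
  where
  partner : ∀ ys → All (R x) ys → Any (λ z → p z ≡ true) ys → ∃₂ λ y z → p y ≡ true × p z ≡ true × R y z
  partner (y ∷ ys) (Rxy ∷ _)    (here py)  = x , y , px , py , Rxy
  partner (y ∷ ys) (_ ∷ Rxys) (there w) = partner ys Rxys w

count-cartesian-pos : {X Y : Set} (c : X × Y → Bool) (xs : List X) (ys : List Y) →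
  Any (λ x → Any (λ y → c (x , y) ≡ true) ys) xs → 0 < count c (cartesianProduct xs ys)
count-cartesian-pos c (x ∷ xs) ys (here w) rewrite count-cartesian c x xs ys =
  ℕ.<-≤-trans (count-pos (λ y → c (x , y)) ys w) (ℕ.m≤m+n _ _)
count-cartesian-pos c (x ∷ xs) ys (there w) rewrite count-cartesian c x xs ys =
  ℕ.<-≤-trans (count-cartesian-pos c xs ys w) (ℕ.m≤n+m _ _)

count-cartesian-≤ : {X Y : Set} (c : X × Y → Bool) (q : X → Bool) (xs : List X) (ys : List Y) →
  (∀ x → count (λ y → c (x , y)) ys ≤ bit (q x)) → count c (cartesianProduct xs ys) ≤ count q xs
count-cartesian-≤ c q []       ys rows = z≤n
count-cartesian-≤ c q (x ∷ xs) ys rows rewrite count-cartesian c x xs ys =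
  ℕ.+-mono-≤ (rows x) (count-cartesian-≤ c q xs ys rows)

count-cartesian-< : {X Y : Set} (c : X × Y → Bool) (q : X → Bool) (xs : List X) (ys : List Y) →
  (∀ x → count (λ y → c (x , y)) ys ≤ bit (q x)) →
  Any (λ x → count (λ y → c (x , y)) ys < bit (q x)) xs →
  count c (cartesianProduct xs ys) < count q xs
count-cartesian-< c q (x ∷ xs) ys rows (here short) rewrite count-cartesian c x xs ys =
  ℕ.+-mono-<-≤ short (count-cartesian-≤ c q xs ys rows)
count-cartesian-< c q (x ∷ xs) ys rows (there w) rewrite count-cartesian c x xs ys =
  ℕ.+-mono-≤-< (rows x) (count-cartesian-< c q xs ys rows w)

∧-true : ∀ {a b c} → a ≡ true → b ≡ true → c ≡ true → (a ∧ b ∧ c) ≡ true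
∧-true refl refl refl = refl

∧-true⁻¹ : ∀ a b c → (a ∧ b ∧ c) ≡ true → a ≡ true × b ≡ true × c ≡ true
∧-true⁻¹ true  true  c abc = refl , refl , abc
∧-true⁻¹ true  false c ()
∧-true⁻¹ false b     c ()

any-true : {X : Set} (f : X → Bool) {x : X} (xs : List X) → x ∈ xs → f x ≡ true → any f xs ≡ true
any-true f (y ∷ ys) (here refl) fx rewrite fx = refl
any-true f (y ∷ ys) (there x∈) fx rewrite any-true f ys x∈ fx = ∨-zeroʳ (f y)

any-false : {X : Set} (f : X → Bool) (xs : List X) → (∀ x → f x ≡ false) → any f xs ≡ false
any-false f []       none = refl
any-false f (x ∷ xs) none rewrite none x = any-false f xs none

isYes-true : ∀ {Q : Set} (d : Dec Q) → Q → ⌊ d ⌋ ≡ true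
isYes-true (yes _) q = refl
isYes-true (no ¬q) q = ⊥-elim (¬q q)

isYes-sound : ∀ {Q : Set} (d : Dec Q) → ⌊ d ⌋ ≡ true → Q
isYes-sound (yes q) _ = q

-- A pigeonhole principle for the enumerated group

module Pigeonhole (G : FiniteAbelianGroup) where
  open FiniteAbelianGroup G using (Carrier; _≈_; elems; complete; distinct)
    renaming (reflexive to ≈-reflexive; sym to ≈-sym; trans to ≈-trans)

  lookup-injective : ∀ xs → AllPairs (λ x y → ¬ x ≈ y) xs →
    ∀ i j → lookup xs i ≈ lookup xs j → i ≡ j
  lookup-injective (x ∷ xs) (x≉ ∷ _)   zero    zero    _ = refl
  lookup-injective (x ∷ xs) (x≉ ∷ _)   zero    (suc j) e = ⊥-elim (All.lookup x≉ (∈-lookup j) e)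
  lookup-injective (x ∷ xs) (x≉ ∷ _)   (suc i) zero    e = ⊥-elim (All.lookup x≉ (∈-lookup i) (≈-sym e))
  lookup-injective (x ∷ xs) (_ ∷ rest) (suc i) (suc j) e = cong suc (lookup-injective xs rest i j e)

  index : Carrier → Fin (length elems)
  index x = Any.index (complete x)

  index-injective : ∀ {x y} → index x ≡ index y → x ≈ y
  index-injective {x} {y} e = ≈-trans (lookup-index (complete x))
    (≈-trans (≈-reflexive (cong (lookup elems) e)) (≈-sym (lookup-index (complete y))))

  injective⇒onto : (f : Carrier → Carrier) → (∀ x y → f x ≈ f y → x ≈ y) →
    (c : Carrier) → ¬ (∀ x → ¬ f x ≈ c)
  injective⇒onto f f-inj c missed with Fin.pigeonhole (ℕ.n<1+n (length elems)) positions
    where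
    positions : Fin (suc (length elems)) → Fin (length elems)
    positions zero    = index c
    positions (suc i) = index (f (lookup elems i))
  ... | zero  , zero  , () , _
  ... | suc i , zero  , () , _
  ... | zero  , suc j , _  , e = missed (lookup elems j) (≈-sym (index-injective e))
  ... | suc i , suc j , i<j , e
    with refl ← lookup-injective elems distinct i j (f-inj _ _ (index-injective e))
    = ℕ.<-irrefl refl i<j

module Subtraction (G : FiniteAbelianGroup) where
  open FiniteAbelianGroup G using (Carrier; _≈_; _∙_; ε; _⁻¹; abGroup; setoid; ∙-cong; ⁻¹-cong; assoc; identityʳ; inverseʳ)
    renaming (refl to ≈-refl; sym to ≈-sym; trans to ≈-trans)
  open AbelianGroupProperties abGroup using (⁻¹-anti-homo‿-; xyx⁻¹≈y; ε⁻¹≈ε; x∙y⁻¹≈ε⇒x≈y)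
  open import Relation.Binary.Reasoning.Setoid setoid

  infixl 6 _−_
  _−_ : Carrier → Carrier → Carrier
  a − b = _-G_ G a b

  sub-sub : ∀ a y → a − (a − y) ≈ y
  sub-sub a y = begin
    a ∙ (a ∙ y ⁻¹) ⁻¹  ≈⟨ ∙-cong ≈-refl (⁻¹-anti-homo‿- a y) ⟩
    a ∙ (y ∙ a ⁻¹)     ≈⟨ ≈-sym (assoc a y (a ⁻¹)) ⟩
    a ∙ y ∙ a ⁻¹       ≈⟨ xyx⁻¹≈y a y ⟩
    y                  ∎

  sub-solve : ∀ {a y δ} → a − y ≈ δ → y ≈ a − δ
  sub-solve {a} {y} a−y≈δ = ≈-trans (≈-sym (sub-sub a y)) (∙-cong ≈-refl (⁻¹-cong a−y≈δ))

  sub-cancelˡ : ∀ {a x y} → a − x ≈ a − y → x ≈ y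
  sub-cancelˡ {a} {x} {y} e = ≈-trans (sub-solve e) (sub-sub a y)

  sub-fixed⇒zero : ∀ {a y} → a − y ≈ a → y ≈ ε
  sub-fixed⇒zero {a} e = ≈-trans (sub-solve e) (inverseʳ a)

  sub-zero : ∀ {δ} x → δ ≈ ε → x − δ ≈ x
  sub-zero x δ≈ε = ≈-trans (∙-cong ≈-refl (≈-trans (⁻¹-cong δ≈ε) ε⁻¹≈ε)) (identityʳ x)

  sub-nonzero : ∀ {a b} → ¬ a ≈ b → ¬ a − b ≈ ε
  sub-nonzero {a} {b} a≉b e = a≉b (x∙y⁻¹≈ε⇒x≈y a b e)

-- Invariant parts of a partition

module Partition (G : FiniteAbelianGroup) {m : ℕ} (A : Family G m) (isPartition : IsPartition G A) where
  open FiniteAbelianGroup G using (Carrier; _≈_; ε; _≈?_; elems; complete; distinct; ∙-cong; ⁻¹-cong)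
    renaming (refl to ≈-refl; sym to ≈-sym; trans to ≈-trans)
  open IsPartition isPartition
  open Subtraction G
  open Pigeonhole G using (injective⇒onto)

  samePart : ∀ {j j' u u'} → A j u ≡ true → A j' u' ≡ true → u ≈ u' → j ≡ j'
  samePart {j} {j'} {u} u∈ u'∈ u≈u' with j Fin.≟ j'
  ... | yes j≡j' = j≡j'
  ... | no j≢j' with () ← disjoint j j' u j≢j' u∈ (trans (respects j' u≈u') u'∈)

  twoElementsOf : ∀ i → 1 < size G A i → ∃₂ λ a a' → A i a ≡ true × A i a' ≡ true × ¬ a ≈ a'
  twoElementsOf i 1<kᵢ = twoWitnesses _ (A i) elems distinct (subst (1 <_) (length-filterᵇ (A i) elems) 1<kᵢ)

  inOther-true : ∀ {i j y} → i ≢ j → A i y ≡ true → inOther G A j y ≡ true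
  inOther-true {i} {j} {y} i≢j y∈Aᵢ = any-true _ (allFin m) (∈-allFin i) other
    where
    other : not ⌊ i Fin.≟ j ⌋ ∧ A i y ≡ true
    other with i Fin.≟ j
    ... | yes i≡j = ⊥-elim (i≢j i≡j)
    ... | no _    = y∈Aᵢ

  inOther-false : ∀ {j y} → A j y ≡ true → inOther G A j y ≡ false
  inOther-false {j} {y} y∈Aⱼ = any-false _ (allFin m) notOther
    where
    notOther : ∀ i → not ⌊ i Fin.≟ j ⌋ ∧ A i y ≡ false
    notOther i with i Fin.≟ j
    ... | yes _   = refl
    ... | no i≢j with A i y in y∈Aᵢ
    ...   | false = refl
    ...   | true with () ← disjoint i j y i≢j y∈Aᵢ y∈Aⱼ

  pairCondition : Fin m → Carrier → Carrier × Carrier → Bool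
  pairCondition j δ (a , b) = A j a ∧ inOther G A j b ∧ ⌊ (a − b) ≈? δ ⌋

  N≡count : ∀ j δ → N G A j δ ≡ count (pairCondition j δ) (cartesianProduct elems elems)
  N≡count j δ = length-filterᵇ (pairCondition j δ) (cartesianProduct elems elems)

  pairCondition-sound : ∀ {j δ a b} → pairCondition j δ (a , b) ≡ true →
    A j a ≡ true × inOther G A j b ≡ true × a − b ≈ δ
  pairCondition-sound {j} {δ} {a} {b} pc with ∧-true⁻¹ (A j a) (inOther G A j b) _ pc
  ... | a∈ , b∈ , a−b≈δ = a∈ , b∈ , isYes-sound ((a − b) ≈? δ) a−b≈δ

  N-pos : ∀ {i j δ a b} → i ≢ j → A j a ≡ true → A i b ≡ true → a − b ≈ δ → 0 < N G A j δ
  N-pos {i} {j} {δ} {a} {b} i≢j a∈ b∈ a−b≈δ rewrite N≡count j δ =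
    count-cartesian-pos (pairCondition j δ) elems elems
      (Any.map (λ a≈a' → Any.map (λ b≈b' → counted a≈a' b≈b') (complete b)) (complete a))
    where
    counted : ∀ {a' b'} → a ≈ a' → b ≈ b' → pairCondition j δ (a' , b') ≡ true
    counted a≈a' b≈b' = ∧-true (trans (sym (respects j a≈a')) a∈)
      (inOther-true i≢j (trans (sym (respects i b≈b')) b∈))
      (isYes-true _ (≈-trans (∙-cong (≈-sym a≈a') (⁻¹-cong (≈-sym b≈b'))) a−b≈δ))

  ShiftInvariant : Fin m → Carrier → Set
  ShiftInvariant j δ = ∀ x → A j x ≡ true → A j (x − δ) ≡ true

  invariant-at-zero : ∀ j {δ} → δ ≈ ε → ShiftInvariant j δ
  invariant-at-zero j δ≈ε x x∈ = trans (respects j (sub-zero x δ≈ε)) x∈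

  N≡0⇒invariant : ∀ {j δ} → N G A j δ ≡ 0 → ShiftInvariant j δ
  N≡0⇒invariant {j} {δ} N≡0 x x∈ with A j (x − δ) in x−δ∈
  ... | true  = refl
  ... | false with covers (x − δ)
  ...   | i , x−δ∈Aᵢ with i Fin.≟ j
  ...     | yes refl with () ← trans (sym x−δ∈Aᵢ) x−δ∈
  ...     | no i≢j = ⊥-elim (ℕ.<-irrefl (sym N≡0) (N-pos i≢j x∈ x−δ∈Aᵢ (sub-sub x δ)))

  -- Each a contributes at most one pair (b is determined as a − δ), and none
  -- unless a ∈ Aⱼ.
  pairsInRow≤ : ∀ j δ a → count (λ b → pairCondition j δ (a , b)) elems ≤ bit (A j a)
  pairsInRow≤ j δ a = bound (A j a) refl
    where
    bound : ∀ s → A j a ≡ s → count (λ b → pairCondition j δ (a , b)) elems ≤ bit s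
    bound true  _   = count-atMostOne (λ b b' → ¬ b ≈ b') _ elems distinct determined
      where
      determined : ∀ {b b'} → pairCondition j δ (a , b) ≡ true → pairCondition j δ (a , b') ≡ true → ¬ ¬ b ≈ b'
      determined pc pc' b≉b' with pairCondition-sound pc | pairCondition-sound pc'
      ... | _ , _ , a−b≈δ | _ , _ , a−b'≈δ = b≉b' (sub-cancelˡ (≈-trans a−b≈δ (≈-sym a−b'≈δ)))
    bound false a∉ = ℕ.≤-reflexive (count-none _ elems (λ b → ¬-not (outside b)))
      where
      outside : ∀ b → pairCondition j δ (a , b) ≢ true
      outside b pc with () ← trans (sym a∉) (proj₁ (pairCondition-sound pc))

  pairsInRow-none : ∀ {j δ a} → A j (a − δ) ≡ true → ∀ b → pairCondition j δ (a , b) ≡ false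
  pairsInRow-none {j} {δ} {a} a−δ∈ b = ¬-not absent
    where
    absent : pairCondition j δ (a , b) ≢ true
    absent pc with pairCondition-sound pc
    ... | _ , b∈other , a−b≈δ with () ← trans (sym b∈other)
            (inOther-false (trans (respects j (sub-solve a−b≈δ)) a−δ∈))

  N<size : ∀ {j δ x} → A j x ≡ true → A j (x − δ) ≡ true → N G A j δ < size G A j
  N<size {j} {δ} {x} x∈ x−δ∈ rewrite N≡count j δ | length-filterᵇ (A j) elems =
    count-cartesian-< (pairCondition j δ) (A j) elems elems (pairsInRow≤ j δ)
      (Any.map rowShort (complete x))
    where
    rowShort : ∀ {x'} → x ≈ x' → count (λ b → pairCondition j δ (x' , b)) elems < bit (A j x')
    rowShort {x'} x≈x'
      rewrite count-none _ elems (pairsInRow-none (trans (sym (respects j (∙-cong x≈x' ≈-refl))) x−δ∈))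
            | trans (sym (respects j x≈x')) x∈ = s≤s z≤n

  -- Choosing parts j(δ) (with j(0) the first part) and representatives
  -- r, the map δ ↦ r(j(δ)) − δ is injective and misses r of the second part.
  noInvariantChoice : 1 < m → ¬ (∀ δ → ¬ δ ≈ ε → ∃ λ j → ShiftInvariant j δ)
  noInvariantChoice (s≤s (s≤s z≤n)) invariantPart =
    injective⇒onto image image-injective (rep second) image-misses
    where
    first second : Fin m
    first  = zero
    second = suc zero

    rep : Fin m → Carrier
    rep j = proj₁ (nonempty j)

    choose : ∀ δ → ∃ λ j → ShiftInvariant j δ × (δ ≈ ε → j ≡ first)
    choose δ with δ ≈? ε
    ... | yes δ≈ε = first , invariant-at-zero first δ≈ε , (λ _ → refl)
    ... | no δ≉ε  = proj₁ (invariantPart δ δ≉ε) , proj₂ (invariantPart δ δ≉ε) , (λ δ≈ε → ⊥-elim (δ≉ε δ≈ε))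

    part : Carrier → Fin m
    part δ = proj₁ (choose δ)

    image : Carrier → Carrier
    image δ = rep (part δ) − δ

    image∈ : ∀ δ → A (part δ) (image δ) ≡ true
    image∈ δ = proj₁ (proj₂ (choose δ)) (rep (part δ)) (proj₂ (nonempty (part δ)))

    image-injective : ∀ δ δ' → image δ ≈ image δ' → δ ≈ δ'
    image-injective δ δ' e =
      sub-cancelˡ (subst (λ j → rep j − δ ≈ image δ') (samePart (image∈ δ) (image∈ δ') e) e)

    image-misses : ∀ δ → ¬ image δ ≈ rep second
    image-misses δ e = Fin.0≢1+n (trans (sym (proj₂ (proj₂ (choose δ)) δ≈ε)) inSecond)
      where
      inSecond : part δ ≡ second
      inSecond = samePart (image∈ δ) (proj₂ (nonempty second)) e
      δ≈ε : δ ≈ ε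
      δ≈ε = sub-fixed⇒zero (subst (λ j → rep j − δ ≈ rep second) inSecond e)

-- Comparing weighted sums of bimodal counts

sum-≤ : {X : Set} (f g : X → ℚ) (xs : List X) → (∀ x → f x ℚ.≤ g x) →
  foldr ℚ._+_ ℚ.0ℚ (map f xs) ℚ.≤ foldr ℚ._+_ ℚ.0ℚ (map g xs)
sum-≤ f g []       f≤g = ℚ.≤-refl
sum-≤ f g (x ∷ xs) f≤g = ℚ.+-mono-≤ (f≤g x) (sum-≤ f g xs f≤g)

sum-< : {X : Set} (f g : X → ℚ) (xs : List X) → (∀ x → f x ℚ.≤ g x) →
  ∀ {x} → x ∈ xs → f x ℚ.< g x → foldr ℚ._+_ ℚ.0ℚ (map f xs) ℚ.< foldr ℚ._+_ ℚ.0ℚ (map g xs)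
sum-< f g (y ∷ ys) f≤g (here refl) f<g = ℚ.+-mono-<-≤ f<g (sum-≤ f g ys f≤g)
sum-< f g (y ∷ ys) f≤g (there x∈) f<g = ℚ.+-mono-≤-< (f≤g y) (sum-< f g ys f≤g x∈ f<g)

module WeightedSums {m : ℕ} (k : Fin m → ℕ) (k≢0 : ∀ j → NonZero (k j)) where

  ratio : (Fin m → ℕ) → Fin m → ℚ
  ratio a j = ((ℤ.+ a j) ℚ./ k j) {{k≢0 j}}

  weightedSum : (Fin m → ℕ) → ℚ
  weightedSum a = foldr ℚ._+_ ℚ.0ℚ (map (ratio a) (allFin m))

  ratio-< : ∀ a b j → a j ≡ 0 → b j ≡ k j → ratio a j ℚ.< ratio b j
  ratio-< a b j aⱼ≡0 bⱼ≡kⱼ rewrite aⱼ≡0 | bⱼ≡kⱼ =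
    subst (ℚ._< ratio k j) (sym (ℚ.0/n≡0 (k j) {{k≢0 j}}))
      (ℚ.positive⁻¹ _ {{ℚ.normalize-pos (k j) (k j) {{k≢0 j}} {{k≢0 j}}}})

  ratio-≤ : ∀ a b j → a j ≡ 0 ⊎ a j ≡ k j → b j ≡ k j → ratio a j ℚ.≤ ratio b j
  ratio-≤ a b j (inj₁ aⱼ≡0)  bⱼ≡kⱼ = ℚ.<⇒≤ (ratio-< a b j aⱼ≡0 bⱼ≡kⱼ)
  ratio-≤ a b j (inj₂ aⱼ≡kⱼ) bⱼ≡kⱼ rewrite aⱼ≡kⱼ | bⱼ≡kⱼ = ℚ.≤-refl

  weightedSum-< : ∀ a b i → (∀ j → a j ≡ 0 ⊎ a j ≡ k j) → (∀ j → b j ≡ k j) → a i ≡ 0 →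
    weightedSum a ℚ.< weightedSum b
  weightedSum-< a b i bimodal full aᵢ≡0 =
    sum-< (ratio a) (ratio b) (allFin m) (λ j → ratio-≤ a b j (bimodal j) (full j))
      (∈-allFin i) (ratio-< a b i aᵢ≡0 (full i))

-- Bimodal partitions whose weighted sums are constant

module BimodalPartition (G : FiniteAbelianGroup) {m : ℕ} (A : Family G m) (P : IsPartition G A)
                        (bimodal : Bimodal G A) where
  open FiniteAbelianGroup G using (Carrier; _≈_; ε) renaming (sym to ≈-sym)
  open Subtraction G
  open Partition G A P
  open WeightedSums (size G A) (size-nonzero G A P)

  counts : Carrier → Fin m → ℕ
  counts δ j = N G A j δ

  -- For a ≠ a' in Aᵢ, the part Aᵢ has no (a' − a)-pairs: a' ∈ Aᵢ and
  -- a' − (a' − a) = a ∈ Aᵢ, so Nᵢ < kᵢ, leaving Nᵢ = 0 by bimodality.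
  N-vanishes-at-difference : ∀ {i a a'} → A i a ≡ true → A i a' ≡ true → ¬ a' − a ≈ ε →
    N G A i (a' − a) ≡ 0
  N-vanishes-at-difference {i} {a} {a'} a∈ a'∈ δ≢0 with bimodal (a' − a) δ≢0 i
  ... | inj₁ N≡0  = N≡0
  ... | inj₂ N≡kᵢ = ⊥-elim (ℕ.<-irrefl N≡kᵢ (N<size a'∈ (trans (IsPartition.respects P i (sub-sub a' a)) a∈)))

  full-counts : ∀ δ → ¬ δ ≈ ε → ¬ (∃ λ j → N G A j δ ≡ 0) → ∀ j → N G A j δ ≡ size G A j
  full-counts δ δ≢0 noneVanish j with bimodal δ δ≢0 j
  ... | inj₁ N≡0  = ⊥-elim (noneVanish (j , N≡0))
  ... | inj₂ N≡kⱼ = N≡kⱼ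

  -- For a ≠ a' in Aᵢ, a nonzero δ without a vanishing count has a larger
  -- weighted sum than a' − a: all its counts are full, while Nᵢ(a' − a) = 0.
  weightedSum-increases : ∀ {i a a' δ} → A i a ≡ true → A i a' ≡ true → ¬ a' − a ≈ ε →
    ¬ δ ≈ ε → ¬ (∃ λ j → N G A j δ ≡ 0) → weightedSum (counts (a' − a)) ℚ.< weightedSum (counts δ)
  weightedSum-increases {i} {a} {a'} {δ} a∈ a'∈ δ₀≢0 δ≢0 noneVanish =
    weightedSum-< (counts (a' − a)) (counts δ) i (bimodal (a' − a) δ₀≢0)
      (full-counts δ δ≢0 noneVanish) (N-vanishes-at-difference a∈ a'∈ δ₀≢0)

  vanishingCount : (∃ λ i → 1 < size G A i) → RWEDF G A P → ∀ δ → ¬ δ ≈ ε → ∃ λ j → N G A j δ ≡ 0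
  vanishingCount (i , 1<kᵢ) (ℓ , constant) δ δ≢0 =
    decidable-stable (Fin.any? (λ j → N G A j δ ℕ.≟ 0)) λ noneVanish →
      let a , a' , a∈ , a'∈ , a≉a' = twoElementsOf i 1<kᵢ
          δ₀≢0 : ¬ a' − a ≈ ε
          δ₀≢0 = sub-nonzero (λ a'≈a → a≉a' (≈-sym a'≈a))
      in ℚ.<-irrefl (trans (constant (a' − a) δ₀≢0) (sym (constant δ δ≢0)))
           (weightedSum-increases a∈ a'∈ δ₀≢0 δ≢0 noneVanish)

mainTheorem17 : (G : FiniteAbelianGroup) (m : ℕ) (A : Family G m)
    (P : IsPartition G A) → Bimodal G A → 1 < m →
    (∃ λ (i : Fin m) → 1 < size G A i) → ¬ RWEDF G A P
mainTheorem17 G m A P bimodal 1<m bigPart rwedf =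
  Partition.noInvariantChoice G A P 1<m λ δ δ≢0 →
    map₂ (Partition.N≡0⇒invariant G A P) (BimodalPartition.vanishingCount G A P bimodal bigPart rwedf δ δ≢0)
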